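{- Let $\mathbb{F}$ be a subfield of a field $\mathbb{K}$ with $\dim_{\mathbb{F}}\mathbb{K}=k$, and let $\varphi:\mathbb{K}\to\mathbb{F}^k$ be an $\mathbb{F}$-linear isomorphism. For $t\ge1$ let $\varphi^t:\mathbb{K}^t\to\mathbb{F}^{kt}$ apply $\varphi$ coordinatewise, and for a matrix $E\in\mathbb{K}^{t\times n}$ let $\varphi^t(E)\in\mathbb{F}^{kt\times n}$ be obtained by applying $\varphi^t$ to each column of $E$. Let $n\ge r\ge1$ and let $\mathcal{E}\subseteq\mathbb{K}^{t\times n}$ be a weak (respectively strong) $(r,L)$-lossless rank condenser over $\mathbb{K}$. Then $\{\varphi^t(E): E\in\mathcal{E}\}\subseteq\mathbb{F}^{kt\times n}$ is a weak (respectively strong) $(r,L)$-lossless rank condenser over $\mathbb{F}$.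
   Context: For a field $\mathbb{L}$, a collection $\mathcal{E}$ of matrices in $\mathbb{L}^{t\times n}$ is a weak $(r,L)$-lossless rank condenser if for every $M\in\mathbb{L}^{n\times r}$ of rank $r$, $|\{E\in\mathcal{E}:\mathrm{rank}\,EM<\mathrm{rank}\,M\}|\le L$, and a strong $(r,L)$-lossless rank condenser if for every such $M$, $\sum_{E\in\mathcal{E}}(\mathrm{rank}\,M-\mathrm{rank}\,EM)\le L$ (ranks over $\mathbb{L}$). -}

module Defs where

open import Level using (Level; _⊔_)
open import Algebra.Bundles using (CommutativeRing)
open import Data.Nat as ℕ using (ℕ; _∸_; _<_; _≤_)
open import Data.Fin using (Fin; zero; suc; remQuot)
open import Data.Product using (Σ; ∃; ∃-syntax; _×_; _,_; proj₁; proj₂)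
open import Data.List using (List; length)
open import Data.List.Relation.Unary.All using (All)
open import Data.List.Relation.Unary.Unique.Propositional using (Unique)
open import Relation.Nullary using (¬_)

record Field (c ℓ : Level) : Set (Level.suc (c ⊔ ℓ)) where
  field
    commutativeRing : CommutativeRing c ℓ
  open CommutativeRing commutativeRing public
  field
    0≉1     : ¬ (0# ≈ 1#)
    inverse : ∀ x → ¬ (x ≈ 0#) → ∃[ y ] (x * y ≈ 1#)

∑ℕ : ∀ {m} → (Fin m → ℕ) → ℕ
∑ℕ {ℕ.zero}  f = 0
∑ℕ {ℕ.suc m} f = f zero ℕ.+ ∑ℕ (λ i → f (suc i))

module LinAlg {c ℓ} (𝔽 : Field c ℓ) where
  open Field 𝔽 hiding (zero)

  ∑ : ∀ {m} → (Fin m → Carrier) → Carrier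
  ∑ {ℕ.zero}  f = 0#
  ∑ {ℕ.suc m} f = f zero + ∑ (λ i → f (suc i))

  Mat : ℕ → ℕ → Set c
  Mat m n = Fin m → Fin n → Carrier

  _·_ : ∀ {m n p} → Mat m n → Mat n p → Mat m p
  (A · B) i j = ∑ (λ l → A i l * B l j)

  LinIndep : ∀ {r m} → (Fin r → Fin m → Carrier) → Set (c ⊔ ℓ)
  LinIndep {r} {m} v =
    ∀ (a : Fin r → Carrier) →
      (∀ i → ∑ (λ j → a j * v j i) ≈ 0#) → ∀ j → a j ≈ 0#

  HasRank : ∀ {m n} → Mat m n → ℕ → Set (c ⊔ ℓ)
  HasRank {m} {n} A ρ =
    (Σ (Fin ρ → Fin n) λ s → LinIndep (λ j i → A i (s j)))
    × (∀ (s : Fin (ℕ.suc ρ) → Fin n) → ¬ LinIndep (λ j i → A i (s j)))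

  -- A collection of matrices is given as an indexed family ℰ : Fin N → Mat t n.
  -- Weak (r,L)-lossless rank condenser: for every M ∈ 𝔽^{n×r} of rank r,
  -- the number of (indices of) members E with rank(EM) < rank M is ≤ L.
  -- "number ≤ L" = every duplicate-free list of such indices has length ≤ L.
  WeakCondenser : ∀ {N t n} → (Fin N → Mat t n) → ℕ → ℕ → Set (c ⊔ ℓ)
  WeakCondenser {N} {t} {n} ℰ r L =
    ∀ (M : Mat n r) → HasRank M r →
    ∀ (xs : List (Fin N)) → Unique xs →
      All (λ e → ∃[ ρ ] (HasRank (ℰ e · M) ρ × ρ < r)) xs →
      length xs ≤ L

  StrongCondenser : ∀ {N t n} → (Fin N → Mat t n) → ℕ → ℕ → Set (c ⊔ ℓ)
  StrongCondenser {N} {t} {n} ℰ r L =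
    ∀ (M : Mat n r) → HasRank M r →
    ∀ (ρ : Fin N → ℕ) → (∀ e → HasRank (ℰ e · M) (ρ e)) →
      ∑ℕ (λ e → r ∸ ρ e) ≤ L

record Subfield {c₁ ℓ₁ c₂ ℓ₂} (𝔽 : Field c₁ ℓ₁) (𝕂 : Field c₂ ℓ₂)
       : Set (c₁ ⊔ ℓ₁ ⊔ c₂ ⊔ ℓ₂) where
  private
    module F = Field 𝔽
    module K = Field 𝕂
  field
    ι       : F.Carrier → K.Carrier
    ι-cong  : ∀ {a b} → a F.≈ b → ι a K.≈ ι b
    ι-+     : ∀ a b → ι (a F.+ b) K.≈ ι a K.+ ι b
    ι-*     : ∀ a b → ι (a F.* b) K.≈ ι a K.* ι b
    ι-1     : ι F.1# K.≈ K.1#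
    ι-inj   : ∀ {a b} → ι a K.≈ ι b → a F.≈ b

record LinIso {c₁ ℓ₁ c₂ ℓ₂} {𝔽 : Field c₁ ℓ₁} {𝕂 : Field c₂ ℓ₂}
       (S : Subfield 𝔽 𝕂) (k : ℕ) : Set (c₁ ⊔ ℓ₁ ⊔ c₂ ⊔ ℓ₂) where
  private
    module F = Field 𝔽
    module K = Field 𝕂
  open Subfield S
  field
    φ      : K.Carrier → Fin k → F.Carrier
    φ-cong : ∀ {x y} → x K.≈ y → ∀ j → φ x j F.≈ φ y j
    φ-+    : ∀ x y j → φ (x K.+ y) j F.≈ φ x j F.+ φ y j
    φ-·    : ∀ a x j → φ (ι a K.* x) j F.≈ a F.* φ x j
    φ-inj  : ∀ {x y} → (∀ j → φ x j F.≈ φ y j) → x K.≈ y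
    φ-surj : ∀ (v : Fin k → F.Carrier) → ∃[ x ] (∀ j → φ x j F.≈ v j)

-- φ^t(E) ∈ 𝔽^{kt×n}: apply φ coordinatewise to each column of E ∈ 𝕂^{t×n};
-- row (i,j) ↦ index i·k + j (block of k rows for each row i of E).
φMat : ∀ {c₁ ℓ₁ c₂ ℓ₂} {𝔽 : Field c₁ ℓ₁} {𝕂 : Field c₂ ℓ₂}
       {S : Subfield 𝔽 𝕂} {k : ℕ} → LinIso S k → ∀ {t n} →
       LinAlg.Mat 𝕂 t n → LinAlg.Mat 𝔽 (t ℕ.* k) n
φMat {k = k} Φ {t} E a col =
  LinIso.φ Φ (E (proj₁ (remQuot {t} k a)) col) (proj₂ (remQuot {t} k a))

module Submission where

-- Write ι : 𝔽 → 𝕂 for the inclusion and ιM for a matrix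
-- M ∈ 𝔽^{n×r} viewed over 𝕂.  Two transfer facts carry the argument:
--   (1) rank_𝕂 (ιM) = rank_𝔽 M, since φ turns a 𝕂-relation among the
--       columns of ιM into k separate 𝔽-relations among the columns of M;
--   (2) rank_𝕂 (E · ιM) ≤ rank_𝔽 (φ^t(E) · M), since φ^t(E) · M is the
--       entrywise image φ^t(E · ιM), and φ^t maps 𝕂-independent vectors to
--       𝔽-independent ones (φ is 𝔽-linear and injective).
-- Hence each E that loses rank on M over 𝔽 already loses at least as much
-- rank on ιM over 𝕂, and both condenser bounds transfer.
--
-- Ranks exist only
-- classically here, but the conclusions are decidable inequalities on ℕ, so
-- the double negation is harmless.

open import Defs
open import Data.Nat as ℕ using (ℕ; _≤_; _∸_; z≤n)
import Data.Nat.Properties as ℕP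
open import Data.Fin using (Fin; zero; suc; combine; remQuot)
import Data.Fin.Properties as FinP
open import Data.Product using (Σ; ∃-syntax; _×_; _,_; proj₁; proj₂)
open import Data.Sum using (inj₁; inj₂)
open import Data.Empty using (⊥-elim)
open import Data.List using (length)
import Data.List.Relation.Unary.All as All
open import Function using (_∘_)
open import Relation.Nullary using (¬_; yes; no)
open import Relation.Nullary.Negation using (¬¬-map; contradiction)
open import Relation.Nullary.Decidable using (¬¬-excluded-middle; decidable-stable)
import Relation.Binary.PropositionalEquality as P
open P using (_≡_; _≢_)
import Relation.Binary.Reasoning.Setoid as SetoidReasoning
import Algebra.Properties.Ring as RingProperties
import Algebra.Properties.Semiring.Sum as SemiringSum

¬¬-lastTrue : ∀ {q} {Q : ℕ → Set q} {m} → Q 0 → ¬ Q m →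
              ¬ ¬ (∃[ ρ ] (Q ρ × ¬ Q (ℕ.suc ρ)))
¬¬-lastTrue {m = ℕ.zero}  q0 ¬qm = contradiction q0 ¬qm
¬¬-lastTrue {m = ℕ.suc m} q0 ¬qm no-last = ¬¬-excluded-middle λ
  { (yes qm) → no-last (m , qm , ¬qm)
  ; (no ¬qm') → ¬¬-lastTrue q0 ¬qm' no-last }

¬¬-finiteChoice : ∀ {N a} {Pr : Fin N → Set a} →
                  (∀ e → ¬ ¬ Pr e) → ¬ ¬ (∀ e → Pr e)
¬¬-finiteChoice {ℕ.zero}  h k = k (λ ())
¬¬-finiteChoice {ℕ.suc N} {Pr = Pr} h k =
  h zero λ p₀ → ¬¬-finiteChoice {Pr = Pr ∘ suc} (h ∘ suc)
    λ rest → k λ { zero → p₀ ; (suc e) → rest e }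

∑ℕ-mono : ∀ {m} {f g : Fin m → ℕ} → (∀ e → f e ≤ g e) → ∑ℕ f ≤ ∑ℕ g
∑ℕ-mono {ℕ.zero}  h = z≤n
∑ℕ-mono {ℕ.suc m} h = ℕP.+-mono-≤ (h zero) (∑ℕ-mono (h ∘ suc))

module Rank {c ℓ} (𝔽 : Field c ℓ) where
  open Field 𝔽 hiding (zero)
  open LinAlg 𝔽
  open SetoidReasoning setoid
  private module Sum = SemiringSum semiring

  columns : ∀ {m n p} → Mat m n → (Fin p → Fin n) → Fin p → Fin m → Carrier
  columns A s j i = A i (s j)

  ∑≡sum : ∀ {m} (f : Fin m → Carrier) → ∑ f ≡ Sum.sum f
  ∑≡sum {ℕ.zero}  f = P.refl
  ∑≡sum {ℕ.suc m} f = P.cong (f zero +_) (∑≡sum (f ∘ suc))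

  ∑-cong : ∀ {m} {f g : Fin m → Carrier} → (∀ i → f i ≈ g i) → ∑ f ≈ ∑ g
  ∑-cong {f = f} {g} f≈g = begin
    ∑ f       ≡⟨ ∑≡sum f ⟩
    Sum.sum f ≈⟨ Sum.sum-cong-≋ f≈g ⟩
    Sum.sum g ≡⟨ ∑≡sum g ⟨
    ∑ g       ∎

  ∑-+ : ∀ {m} (f g : Fin m → Carrier) → ∑ (λ i → f i + g i) ≈ ∑ f + ∑ g
  ∑-+ f g = begin
    ∑ (λ i → f i + g i)       ≡⟨ ∑≡sum (λ i → f i + g i) ⟩
    Sum.sum (λ i → f i + g i) ≈⟨ Sum.∑-distrib-+ f g ⟩
    Sum.sum f + Sum.sum g     ≡⟨ P.cong₂ _+_ (∑≡sum f) (∑≡sum g) ⟨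
    ∑ f + ∑ g                 ∎

  ∑-0 : ∀ {m} → ∑ {m} (λ _ → 0#) ≈ 0#
  ∑-0 {m} = trans (reflexive (∑≡sum {m} (λ _ → 0#))) (Sum.sum-replicate-zero m)

  single : ∀ {m} → Fin m → Carrier → Fin m → Carrier
  single zero    x zero    = x
  single zero    x (suc _) = 0#
  single (suc _) x zero    = 0#
  single (suc i) x (suc l) = single i x l

  single-at : ∀ {m} (i : Fin m) x → single i x i ≈ x
  single-at zero    x = refl
  single-at (suc i) x = single-at i x

  single-off : ∀ {m} (i j : Fin m) x → i ≢ j → single i x j ≈ 0#
  single-off zero    zero    x i≢j = ⊥-elim (i≢j P.refl)
  single-off zero    (suc j) x i≢j = refl
  single-off (suc i) zero    x i≢j = refl
  single-off (suc i) (suc j) x i≢j = single-off i j x (i≢j ∘ P.cong suc)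

  ∑-single : ∀ {m} (i : Fin m) x (w : Fin m → Carrier) →
             ∑ (λ l → single i x l * w l) ≈ x * w i
  ∑-single {ℕ.suc m} zero x w = begin
    x * w zero + ∑ (λ l → 0# * w (suc l)) ≈⟨ +-congˡ (trans (∑-cong (zeroˡ ∘ w ∘ suc)) (∑-0 {m})) ⟩
    x * w zero + 0#                       ≈⟨ +-identityʳ _ ⟩
    x * w zero                            ∎
  ∑-single {ℕ.suc m} (suc i) x w = begin
    0# * w zero + ∑ (λ l → single i x l * w (suc l)) ≈⟨ +-cong (zeroˡ _) (∑-single i x (w ∘ suc)) ⟩
    0# + x * w (suc i)                               ≈⟨ +-identityˡ _ ⟩
    x * w (suc i)                                    ∎

  repeated⇒dependent : ∀ {p m} (v : Fin p → Fin m → Carrier) (i j : Fin p) →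
                       i ≢ j → (∀ x → v i x ≈ v j x) → ¬ LinIndep v
  repeated⇒dependent v i j i≢j vi≈vj indep =
    0≉1 (trans (sym (indep a relation i)) aᵢ≈1)
    where
      a : Fin _ → Carrier
      a l = single i 1# l + single j (- 1#) l

      aᵢ≈1 : a i ≈ 1#
      aᵢ≈1 = trans (+-cong (single-at i 1#) (single-off j i (- 1#) (i≢j ∘ P.sym)))
                   (+-identityʳ 1#)

      relation : ∀ x → ∑ (λ l → a l * v l x) ≈ 0#
      relation x = begin
        ∑ (λ l → a l * v l x)
          ≈⟨ ∑-cong (λ l → distribʳ (v l x) _ _) ⟩
        ∑ (λ l → single i 1# l * v l x + single j (- 1#) l * v l x)
          ≈⟨ ∑-+ (λ l → single i 1# l * v l x) (λ l → single j (- 1#) l * v l x) ⟩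
        ∑ (λ l → single i 1# l * v l x) + ∑ (λ l → single j (- 1#) l * v l x)
          ≈⟨ +-cong (∑-single i 1# (λ l → v l x)) (∑-single j (- 1#) (λ l → v l x)) ⟩
        1# * v i x + - 1# * v j x ≈⟨ +-congˡ (*-congˡ (sym (vi≈vj x))) ⟩
        1# * v i x + - 1# * v i x ≈⟨ distribʳ _ _ _ ⟨
        (1# + - 1#) * v i x       ≈⟨ *-congʳ (-‿inverseʳ 1#) ⟩
        0# * v i x                ≈⟨ zeroˡ _ ⟩
        0#                        ∎

  tooManyColumns : ∀ {m n} (A : Mat m n) (s : Fin (ℕ.suc n) → Fin n) →
                   ¬ LinIndep (columns A s)
  tooManyColumns {n = n} A s with FinP.pigeonhole (ℕP.n<1+n n) s
  ... | i , j , i<j , sᵢ≡sⱼ =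
    repeated⇒dependent (columns A s) i j (FinP.<⇒≢ i<j) (λ x → reflexive (P.cong (A x) sᵢ≡sⱼ))

  LinIndep-tail : ∀ {p m} (v : Fin (ℕ.suc p) → Fin m → Carrier) →
                  LinIndep v → LinIndep (v ∘ suc)
  LinIndep-tail v indep a relation j = indep a′ relation′ (suc j)
    where
      a′ : Fin _ → Carrier
      a′ zero    = 0#
      a′ (suc j) = a j
      relation′ : ∀ i → ∑ (λ j → a′ j * v j i) ≈ 0#
      relation′ i = trans (+-cong (zeroˡ _) (relation i)) (+-identityʳ 0#)

  LinIndep-resp : ∀ {p m} {v w : Fin p → Fin m → Carrier} →
                  (∀ j i → v j i ≈ w j i) → LinIndep v → LinIndep w
  LinIndep-resp v≈w indep a relation =
    indep a (λ i → trans (∑-cong (λ j → *-congˡ (v≈w j i))) (relation i))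

  indep≤rank : ∀ {m n ρ} (A : Mat m n) → HasRank A ρ →
               ∀ {p} (s : Fin p → Fin n) → LinIndep (columns A s) → p ≤ ρ
  indep≤rank A rank {ℕ.zero} s indep = z≤n
  indep≤rank A rank@(_ , maximal) {ℕ.suc p} s indep
    with ℕP.m≤n⇒m<n∨m≡n (indep≤rank A rank (s ∘ suc) (LinIndep-tail (columns A s) indep))
  ... | inj₁ p<ρ    = p<ρ
  ... | inj₂ P.refl = contradiction indep (maximal s)

  -- Every matrix has a rank, classically: the largest size of an independent
  -- selection of columns, which lies between 0 and n.
  ¬¬-rank : ∀ {m n} (A : Mat m n) → ¬ ¬ (∃[ ρ ] HasRank A ρ)
  ¬¬-rank {n = n} A = ¬¬-map toRank
    (¬¬-lastTrue {Q = IndepOfSize} {m = ℕ.suc n} ((λ ()) , λ _ _ ())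
                 (λ (s , indep) → tooManyColumns A s indep))
    where
      IndepOfSize : ℕ → Set _
      IndepOfSize ρ = Σ (Fin ρ → Fin n) (LinIndep ∘ columns A)

      toRank : ∃[ ρ ] (IndepOfSize ρ × ¬ IndepOfSize (ℕ.suc ρ)) → ∃[ ρ ] HasRank A ρ
      toRank (ρ , present , ¬larger) = ρ , present , λ s indep → ¬larger (s , indep)

module Transfer {c₁ ℓ₁ c₂ ℓ₂} {𝔽 : Field c₁ ℓ₁} {𝕂 : Field c₂ ℓ₂}
                {S : Subfield 𝔽 𝕂} {k : ℕ} (Φ : LinIso S k) where
  private
    module F = Field 𝔽
    module K = Field 𝕂
    module LF = LinAlg 𝔽
    module LK = LinAlg 𝕂
    module RF = Rank 𝔽
    module RK = Rank 𝕂
  open Subfield S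
  open LinIso Φ

  ι-0 : ι F.0# K.≈ K.0#
  ι-0 = RingProperties.x+x≈x⇒x≈0 K.ring _
          (K.trans (K.sym (ι-+ F.0# F.0#)) (ι-cong (F.+-identityʳ F.0#)))

  φ-0 : ∀ j → φ K.0# j F.≈ F.0#
  φ-0 j = RingProperties.x+x≈x⇒x≈0 F.ring _
            (F.trans (F.sym (φ-+ K.0# K.0# j)) (φ-cong (K.+-identityʳ K.0#) j))

  φ-∑ : ∀ {m} (f : Fin m → K.Carrier) j → φ (LK.∑ f) j F.≈ LF.∑ (λ i → φ (f i) j)
  φ-∑ {ℕ.zero}  f j = φ-0 j
  φ-∑ {ℕ.suc m} f j = F.trans (φ-+ _ _ j) (F.+-congˡ (φ-∑ (f ∘ suc) j))

  φ-·ʳ : ∀ x a j → φ (x K.* ι a) j F.≈ φ x j F.* a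
  φ-·ʳ x a j = F.trans (φ-cong (K.*-comm x (ι a)) j) (F.trans (φ-· a x j) (F.*-comm _ _))

  ιMat : ∀ {n r} → LF.Mat n r → LK.Mat n r
  ιMat M l c = ι (M l c)

  φVec : ∀ {t} → (Fin t → K.Carrier) → Fin (t ℕ.* k) → F.Carrier
  φVec {t} u α = φ (u (proj₁ (remQuot {t} k α))) (proj₂ (remQuot {t} k α))

  -- (1a) Vectors independent over 𝔽 stay independent over 𝕂: coordinate j of
  -- φ turns a 𝕂-relation into the 𝔽-relation with coefficients φ(aᵢ)ⱼ.
  ι-preservesIndep : ∀ {p m} (w : Fin p → Fin m → F.Carrier) →
                     LF.LinIndep w → LK.LinIndep (λ j i → ι (w j i))
  ι-preservesIndep w indep a relation j =
    φ-inj (λ q → F.trans (indep (λ j → φ (a j) q) (coordinate q) j) (F.sym (φ-0 q)))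
    where
      open SetoidReasoning F.setoid
      coordinate : ∀ q i → LF.∑ (λ j → φ (a j) q F.* w j i) F.≈ F.0#
      coordinate q i = begin
        LF.∑ (λ j → φ (a j) q F.* w j i)     ≈⟨ RF.∑-cong (λ j → φ-·ʳ (a j) (w j i) q) ⟨
        LF.∑ (λ j → φ (a j K.* ι (w j i)) q) ≈⟨ φ-∑ (λ j → a j K.* ι (w j i)) q ⟨
        φ (LK.∑ (λ j → a j K.* ι (w j i))) q ≈⟨ φ-cong (relation i) q ⟩
        φ K.0# q                             ≈⟨ φ-0 q ⟩
        F.0#                                 ∎

  -- (1) M and ιM have the same rank; r + 1 columns are never independent.
  ι-preservesRank : ∀ {n r} (M : LF.Mat n r) → LF.HasRank M r → LK.HasRank (ιMat M) r
  ι-preservesRank M ((s , indep) , _) =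
    (s , ι-preservesIndep (RF.columns M s) indep) , RK.tooManyColumns (ιMat M)

  -- (2a) φ^t maps 𝕂-independent vectors to 𝔽-independent ones: an 𝔽-relation
  -- among the images is, coordinate by coordinate, φ of a 𝕂-relation with
  -- coefficients ι(aⱼ).
  φ-preservesIndep : ∀ {p t} (u : Fin p → Fin t → K.Carrier) →
                     LK.LinIndep u → LF.LinIndep (φVec ∘ u)
  φ-preservesIndep {t = t} u indep a relation j =
    ι-inj (K.trans (indep (ι ∘ a) relationK j) (K.sym ι-0))
    where
      open SetoidReasoning F.setoid
      relationK : ∀ q → LK.∑ (λ j → ι (a j) K.* u j q) K.≈ K.0#
      relationK q = φ-inj λ p′ → begin
        φ (LK.∑ (λ j → ι (a j) K.* u j q)) p′ ≈⟨ φ-∑ (λ j → ι (a j) K.* u j q) p′ ⟩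
        LF.∑ (λ j → φ (ι (a j) K.* u j q) p′) ≈⟨ RF.∑-cong (λ j → φ-· (a j) (u j q) p′) ⟩
        LF.∑ (λ j → a j F.* φ (u j q) p′)     ≡⟨ P.cong (λ qp → LF.∑ (λ j → a j F.* φ (u j (proj₁ qp)) (proj₂ qp)))
                                                        (FinP.remQuot-combine {t} {k} q p′) ⟨
        LF.∑ (λ j → a j F.* φVec (u j) (combine q p′)) ≈⟨ relation (combine q p′) ⟩
        F.0#                                  ≈⟨ φ-0 p′ ⟨
        φ K.0# p′                             ∎

  φMat-· : ∀ {t n r} (E : LK.Mat t n) (M : LF.Mat n r) α c →
           φMat Φ (E LK.· ιMat M) α c F.≈ (φMat Φ E LF.· M) α c
  φMat-· {t} E M α c =
    F.trans (φ-∑ (λ l → E i l K.* ι (M l c)) q) (RF.∑-cong (λ l → φ-·ʳ (E i l) (M l c) q))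
    where
      i : Fin t
      i = proj₁ (remQuot {t} k α)
      q : Fin k
      q = proj₂ (remQuot {t} k α)

  rank-≤ : ∀ {t n r ρK ρF} (E : LK.Mat t n) (M : LF.Mat n r) →
           LK.HasRank (E LK.· ιMat M) ρK → LF.HasRank (φMat Φ E LF.· M) ρF → ρK ≤ ρF
  rank-≤ E M ((s , indepK) , _) rankF =
    RF.indep≤rank (φMat Φ E LF.· M) rankF s
      (RF.LinIndep-resp (λ j α → φMat-· E M α (s j))
        (φ-preservesIndep (λ j q → (E LK.· ιMat M) q (s j)) indepK))

proposition8p5 :
    ∀ {c₁ ℓ₁ c₂ ℓ₂} (𝔽 : Field c₁ ℓ₁) (𝕂 : Field c₂ ℓ₂)
      (S : Subfield 𝔽 𝕂) (k : ℕ) (Φ : LinIso S k)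
      (t n r L N : ℕ) → 1 ≤ t → 1 ≤ r → r ≤ n →
      (ℰ : Fin N → LinAlg.Mat 𝕂 t n) →
      (LinAlg.WeakCondenser 𝕂 ℰ r L →
         LinAlg.WeakCondenser 𝔽 (λ e → φMat Φ (ℰ e)) r L)
      × (LinAlg.StrongCondenser 𝕂 ℰ r L →
         LinAlg.StrongCondenser 𝔽 (λ e → φMat Φ (ℰ e)) r L)
proposition8p5 𝔽 𝕂 S k Φ t n r L N _ _ _ ℰ = weak , strong
  where
    open Transfer Φ
    module LK = LinAlg 𝕂

    ranksK : (M : LinAlg.Mat 𝔽 n r) → ¬ ¬ (∀ e → ∃[ ρ ] LK.HasRank (ℰ e LK.· ιMat M) ρ)
    ranksK M = ¬¬-finiteChoice (λ e → Rank.¬¬-rank 𝕂 (ℰ e LK.· ιMat M))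

    weak : LinAlg.WeakCondenser 𝕂 ℰ r L → LinAlg.WeakCondenser 𝔽 (λ e → φMat Φ (ℰ e)) r L
    weak condK M rankM xs unique lossyF =
      decidable-stable (length xs ℕP.≤? L) (¬¬-map countK (ranksK M))
      where
        countK : (∀ e → ∃[ ρ ] LK.HasRank (ℰ e LK.· ιMat M) ρ) → length xs ≤ L
        countK ranks = condK (ιMat M) (ι-preservesRank M rankM) xs unique
          (All.map (λ { {e} (ρF , rankF , ρF<r) →
                        let ρK , rankK = ranks e
                        in ρK , rankK , ℕP.≤-<-trans (rank-≤ (ℰ e) M rankK rankF) ρF<r })
                   lossyF)

    strong : LinAlg.StrongCondenser 𝕂 ℰ r L → LinAlg.StrongCondenser 𝔽 (λ e → φMat Φ (ℰ e)) r L
    strong condK M rankM ρF rankF =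
      decidable-stable (_ ℕP.≤? L) (¬¬-map deficiencyK (ranksK M))
      where
        deficiencyK : (∀ e → ∃[ ρ ] LK.HasRank (ℰ e LK.· ιMat M) ρ) → ∑ℕ (λ e → r ∸ ρF e) ≤ L
        deficiencyK ranks = ℕP.≤-trans
          (∑ℕ-mono (λ e → ℕP.∸-monoʳ-≤ r (rank-≤ (ℰ e) M (proj₂ (ranks e)) (rankF e))))
          (condK (ιMat M) (ι-preservesRank M rankM) (proj₁ ∘ ranks) (proj₂ ∘ ranks))
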